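{- Consider the rational numbers $\mathbb{Q}$ as a dihedral rack, i.e. with operation $x\triangleright y=2x-y$. Then the nonempty subracks of $\mathbb{Q}$ are exactly the cosets $H+x$ of the subgroups $H$ of the additive group $\mathbb{Q}$, $x\in\mathbb{Q}$.
   Context: A rack is a set $R$ with a binary operation $\triangleright$ such that $a\triangleright(b\triangleright c)=(a\triangleright b)\triangleright(a\triangleright c)$ for all $a,b,c\in R$, and for all $a,b\in R$ there is a unique $x\in R$ with $a\triangleright x=b$. A subrack of $R$ is a subset $Q$ such that $(Q,\triangleright)$ is a rack. -}

module Defs where

open import Level using (Level; _⊔_; suc)
open import Data.Rational using (ℚ; _+_; _-_; -_; 0ℚ; 1ℚ)
open import Data.Product using (Σ; ∃; _×_; _,_; ∃-syntax)
open import Relation.Binary.PropositionalEquality using (_≡_)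
open import Relation.Unary using (Pred; _∈_)

_▷_ : ℚ → ℚ → ℚ
x ▷ y = (x + x) - y

infixl 7 _▷_

record IsSubrack {ℓ : Level} (Q : Pred ℚ ℓ) : Set ℓ where
  field
    closed   : ∀ {a b} → a ∈ Q → b ∈ Q → (a ▷ b) ∈ Q
    selfDist : ∀ {a b c} → a ∈ Q → b ∈ Q → c ∈ Q →
               a ▷ (b ▷ c) ≡ (a ▷ b) ▷ (a ▷ c)
    solve    : ∀ {a b} → a ∈ Q → b ∈ Q →
               Σ ℚ λ x → x ∈ Q × a ▷ x ≡ b ×
                 (∀ y → y ∈ Q → a ▷ y ≡ b → y ≡ x)

NonEmpty : {ℓ : Level} → Pred ℚ ℓ → Set ℓ
NonEmpty Q = ∃[ x ] x ∈ Q

record IsAddSubgroup {ℓ : Level} (H : Pred ℚ ℓ) : Set ℓ where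
  field
    zero∈ : 0ℚ ∈ H
    +-closed : ∀ {a b} → a ∈ H → b ∈ H → (a + b) ∈ H
    neg-closed : ∀ {a} → a ∈ H → (- a) ∈ H

Coset : {ℓ : Level} → Pred ℚ ℓ → ℚ → Pred ℚ ℓ
Coset H x y = ∃[ h ] (h ∈ H × y ≡ h + x)

_≐_ : {ℓ₁ ℓ₂ : Level} → Pred ℚ ℓ₁ → Pred ℚ ℓ₂ → Set (ℓ₁ ⊔ ℓ₂)
P ≐ Q = (∀ y → y ∈ P → y ∈ Q) × (∀ y → y ∈ Q → y ∈ P)

module Submission where

-- Every ▷-closed subset of ℚ is automatically a subrack, because ▷ is
-- self-distributive and involutive (a ▷ (a ▷ b) = b) on all of ℚ; this gives
-- the backward direction, as cosets are ▷-closed.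
--
-- For the forward direction, translating S by one of its points s gives a
-- ▷-closed set H = S - s containing 0, and it remains to show that such a set
-- is an additive subgroup. Negation is x ↦ 0 ▷ x. Closure under addition is
-- the real content: two rationals x, y are integer multiples of a common
-- 1/(e+1), the set of integers k with k/(e+1) ∈ H is a ▷-closed subset of ℤ
-- containing 0, and for subsets of ℤ a Euclidean descent on m + n shows that
-- m, n ∈ P implies m - n ∈ P.

open import Defs
open import Level using (Level)
open import Data.Rational using (ℚ)
open import Data.Product using (Σ; _×_; ∃-syntax)
open import Relation.Unary using (Pred)

open import Data.Rational using (_+_; _-_; -_; 0ℚ; _/_; ↥_; ↧_; ↧ₙ_; toℚᵘ; fromℚᵘ)
import Data.Rational.Properties as ℚP
open import Data.Rational.Solver using (module +-*-Solver)
import Data.Rational.Unnormalised as ℚᵘ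
import Data.Rational.Unnormalised.Properties as ℚᵘP
open import Data.Integer as ℤ using (ℤ; +_; -[1+_]; 0ℤ; _⊖_)
import Data.Integer.Properties as ℤP
import Data.Integer.Solver as ℤSolver
open import Data.Nat as ℕ using (ℕ; zero; suc; _<_; compare; less; equal; greater)
import Data.Nat.Properties as ℕP
open import Data.Nat.Induction using (<-rec)
open import Data.Nat.Tactic.RingSolver using () renaming (solve to ℕ-solve)
open import Data.List using (_∷_; [])
open import Data.Product using (_,_; proj₂)
open import Relation.Binary.PropositionalEquality
open import Relation.Unary using (_∈_)

_▷ℤ_ : ℤ → ℤ → ℤ
a ▷ℤ b = (a ℤ.+ a) ℤ.- b

infixl 7 _▷ℤ_

⊖-≡ : ∀ a b c d → a ℕ.+ d ≡ c ℕ.+ b → a ⊖ b ≡ c ⊖ d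
⊖-≡ a b c d eq = begin
  a ⊖ b                            ≡⟨ ℤP.m-n≡m⊖n a b ⟨
  + a ℤ.- + b                      ≡⟨ solve 3 (λ a b d → a :- b := (a :+ d) :- (b :+ d)) refl (+ a) (+ b) (+ d) ⟩
  (+ a ℤ.+ + d) ℤ.- (+ b ℤ.+ + d)  ≡⟨ cong₂ ℤ._-_ sums (ℤP.+-comm (+ b) (+ d)) ⟩
  (+ c ℤ.+ + b) ℤ.- (+ d ℤ.+ + b)  ≡⟨ solve 3 (λ b c d → (c :+ b) :- (d :+ b) := c :- d) refl (+ b) (+ c) (+ d) ⟩
  + c ℤ.- + d                      ≡⟨ ℤP.m-n≡m⊖n c d ⟩
  c ⊖ d                            ∎
  where
  open ≡-Reasoning
  open ℤSolver.+-*-Solver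
  sums : + a ℤ.+ + d ≡ + c ℤ.+ + b
  sums = trans (sym (ℤP.pos-+ a d)) (trans (cong +_ eq) (ℤP.pos-+ c b))

▷-⊖ : ∀ a b c → + a ▷ℤ (b ⊖ c) ≡ (a ℕ.+ a ℕ.+ c) ⊖ b
▷-⊖ a b c = begin
  (+ a ℤ.+ + a) ℤ.- (b ⊖ c)        ≡⟨ cong (λ u → (+ a ℤ.+ + a) ℤ.- u) (ℤP.m-n≡m⊖n b c) ⟨
  (+ a ℤ.+ + a) ℤ.- (+ b ℤ.- + c)  ≡⟨ solve 3 (λ a b c → (a :+ a) :- (b :- c) := ((a :+ a) :+ c) :- b) refl (+ a) (+ b) (+ c) ⟩
  ((+ a ℤ.+ + a) ℤ.+ + c) ℤ.- + b  ≡⟨ cong (λ u → (u ℤ.+ + c) ℤ.- + b) (ℤP.pos-+ a a) ⟨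
  (+ (a ℕ.+ a) ℤ.+ + c) ℤ.- + b    ≡⟨ cong (ℤ._- + b) (ℤP.pos-+ (a ℕ.+ a) c) ⟨
  + (a ℕ.+ a ℕ.+ c) ℤ.- + b        ≡⟨ ℤP.m-n≡m⊖n (a ℕ.+ a ℕ.+ c) b ⟩
  (a ℕ.+ a ℕ.+ c) ⊖ b              ∎
  where
  open ≡-Reasoning
  open ℤSolver.+-*-Solver

<-witness : ∀ {x y} g → x ℕ.+ suc g ≡ y → x < y
<-witness {x} g refl = ℕP.m<m+n x (ℕ.s≤s ℕ.z≤n)

-- The core is a Euclidean descent showing
-- P (+ m) → P (+ n) → P (m ⊖ n) by strong induction on m + n.
module ReflectionClosed {ℓ : Level} (P : Pred ℤ ℓ) (P-0 : P 0ℤ)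
  (P-▷ : ∀ {a b} → P a → P b → P (a ▷ℤ b)) where

  P-≡ : ∀ {a b} → a ≡ b → P a → P b
  P-≡ = subst P

  -- -a = 0 ▷ a
  P-neg : ∀ {a} → P a → P (ℤ.- a)
  P-neg {a} pa = P-≡ (ℤP.+-identityˡ (ℤ.- a)) (P-▷ P-0 pa)

  P-swap : ∀ m n → P (m ⊖ n) → P (n ⊖ m)
  P-swap m n p = P-≡ (sym (ℤP.⊖-swap n m)) (P-neg p)

  Below : ℕ → Set ℓ
  Below s = ∀ a b → a ℕ.+ b < s → P (+ a) → P (+ b) → P (a ⊖ b)

  -- Compare the gap d + 1 with m:
  --  * gap < m, m = (d + 1) + (k + 1): reflecting n through m gives k + 1, and
  --    (k + 1) - m = m - n, a pair of smaller size;
  --  * gap = m: m - n = -m;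
  --  * gap > m, d = m + k: reflecting n through m gives -(k + 1); for m > 0 the
  --    smaller pair (m, k + 1) gives m - (k + 1), then m ▷ (m - (k + 1)) = n - m.
  sub-gap : ∀ m d → Below (m ℕ.+ suc (m ℕ.+ d)) →
            P (+ m) → P (+ suc (m ℕ.+ d)) → P (m ⊖ suc (m ℕ.+ d))
  sub-gap m d IH pm pn with compare (suc d) m
  ... | less .(suc d) k =
    P-≡ (⊖-≡ (suc k) m m (suc (m ℕ.+ d)) e-result)
        (IH (suc k) m (<-witness (suc (d ℕ.+ d)) e-bound) pk pm)
    where
    e-reflect : m ℕ.+ m ℕ.+ 0 ℕ.+ 0 ≡ suc k ℕ.+ suc (m ℕ.+ d)
    e-reflect = ℕ-solve (d ∷ k ∷ [])
    e-result : suc k ℕ.+ suc (m ℕ.+ d) ≡ m ℕ.+ m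
    e-result = ℕ-solve (d ∷ k ∷ [])
    e-bound : suc k ℕ.+ m ℕ.+ suc (suc (d ℕ.+ d)) ≡ m ℕ.+ suc (m ℕ.+ d)
    e-bound = ℕ-solve (d ∷ k ∷ [])
    pk : P (+ suc k)
    pk = P-≡ (trans (▷-⊖ m (suc (m ℕ.+ d)) 0)
                    (⊖-≡ (m ℕ.+ m ℕ.+ 0) (suc (m ℕ.+ d)) (suc k) 0 e-reflect))
             (P-▷ pm pn)
  ... | equal .(suc d) = P-≡ (⊖-≡ 0 m m (suc (m ℕ.+ d)) e-result) (P-swap m 0 pm)
    where
    e-result : 0 ℕ.+ suc (m ℕ.+ d) ≡ m ℕ.+ m
    e-result = ℕ-solve (d ∷ [])
  sub-gap zero d IH pm pn | greater .zero k = P-swap (suc d) 0 pn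
  sub-gap m@(suc i) d IH pm pn | greater .m k =
    P-≡ (⊖-≡ m (m ℕ.+ m ℕ.+ suc k) m (suc (m ℕ.+ d)) e-result)
        (P-swap (m ℕ.+ m ℕ.+ suc k) m (P-≡ (▷-⊖ m m (suc k)) (P-▷ pm pmk)))
    where
    e-reflect : m ℕ.+ m ℕ.+ 0 ℕ.+ suc k ≡ 0 ℕ.+ suc (m ℕ.+ d)
    e-reflect = ℕ-solve (i ∷ k ∷ [])
    e-bound : m ℕ.+ suc k ℕ.+ suc (suc (i ℕ.+ i)) ≡ m ℕ.+ suc (m ℕ.+ d)
    e-bound = ℕ-solve (i ∷ k ∷ [])
    e-result : m ℕ.+ suc (m ℕ.+ d) ≡ m ℕ.+ (m ℕ.+ m ℕ.+ suc k)
    e-result = ℕ-solve (i ∷ k ∷ [])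
    pk : P (+ suc k)
    pk = P-swap 0 (suc k) (P-≡ (trans (▷-⊖ m (suc (m ℕ.+ d)) 0)
                                      (⊖-≡ (m ℕ.+ m ℕ.+ 0) (suc (m ℕ.+ d)) 0 (suc k) e-reflect))
                               (P-▷ pm pn))
    pmk : P (m ⊖ suc k)
    pmk = IH m (suc k) (<-witness (suc (i ℕ.+ i)) e-bound) pm pk

  sub-ℕ : ∀ m n → P (+ m) → P (+ n) → P (m ⊖ n)
  sub-ℕ m n = <-rec Below step (suc (m ℕ.+ n)) m n (ℕP.n<1+n (m ℕ.+ n))
    where
    step : ∀ s → (∀ {s'} → s' < s → Below s') → Below s
    step s rec a b a+b<s pa pb with compare a b
    ... | less .a k = sub-gap a k (rec a+b<s) pa pb
    ... | equal .a = P-≡ (sym (ℤP.n⊖n≡0 a)) P-0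
    ... | greater .b k =
      P-swap b a (sub-gap b k (rec (subst (_< s) (ℕP.+-comm a b) a+b<s)) pb pa)

  -- m + n = m ▷ (m - n)
  P-+ℕ : ∀ m n → P (+ m) → P (+ n) → P (+ m ℤ.+ + n)
  P-+ℕ m n pm pn = P-≡ sum (P-▷ pm (sub-ℕ m n pm pn))
    where
    sum : + m ▷ℤ (m ⊖ n) ≡ + m ℤ.+ + n
    sum = begin
      + m ▷ℤ (m ⊖ n)           ≡⟨ ▷-⊖ m m n ⟩
      (m ℕ.+ m ℕ.+ n) ⊖ m      ≡⟨ ⊖-≡ (m ℕ.+ m ℕ.+ n) m (m ℕ.+ n) 0 (ℕ-solve (m ∷ n ∷ [])) ⟩
      + (m ℕ.+ n)              ≡⟨ ℤP.pos-+ m n ⟩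
      + m ℤ.+ + n              ∎
      where open ≡-Reasoning

  P-+ : ∀ a b → P a → P b → P (a ℤ.+ b)
  P-+ (+ m) (+ n) = P-+ℕ m n
  P-+ (+ m) -[1+ n ] pa pb = sub-ℕ m (suc n) pa (P-neg pb)
  P-+ -[1+ m ] (+ n) pa pb = sub-ℕ n (suc m) pb (P-neg pa)
  P-+ -[1+ m ] -[1+ n ] pa pb =
    P-≡ (ℤP.neg-distrib-+ (+ suc m) (+ suc n))
        (P-neg (P-+ℕ (suc m) (suc n) (P-neg pa) (P-neg pb)))

module _ where
  open +-*-Solver

  ▷-selfDistributive : ∀ a b c → a ▷ (b ▷ c) ≡ (a ▷ b) ▷ (a ▷ c)
  ▷-selfDistributive = solve 3 (λ a b c →
    (a :+ a) :- ((b :+ b) :- c) := (((a :+ a) :- b) :+ ((a :+ a) :- b)) :- ((a :+ a) :- c)) refl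

  ▷-involutive : ∀ a b → a ▷ (a ▷ b) ≡ b
  ▷-involutive = solve 2 (λ a b → (a :+ a) :- ((a :+ a) :- b) := b) refl

  ▷-translate : ∀ a b s → (a + s) ▷ (b + s) ≡ (a ▷ b) + s
  ▷-translate = solve 3 (λ a b s → ((a :+ s) :+ (a :+ s)) :- (b :+ s) := ((a :+ a) :- b) :+ s) refl

  0▷ : ∀ x → 0ℚ ▷ x ≡ - x
  0▷ = solve 1 (λ x → (con 0ℚ :+ con 0ℚ) :- x := :- x) refl

▷-Closed : {ℓ : Level} → Pred ℚ ℓ → Set ℓ
▷-Closed Q = ∀ a b → a ∈ Q → b ∈ Q → (a ▷ b) ∈ Q

-- Since ▷ is self-distributive and involutive on all of ℚ, every ▷-closed
-- subset is a subrack: the unique solution of a ▷ x = b is x = a ▷ b.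
▷-closed⇒subrack : {ℓ : Level} {Q : Pred ℚ ℓ} → ▷-Closed Q → IsSubrack Q
▷-closed⇒subrack closed = record
  { closed   = λ {a} {b} → closed a b
  ; selfDist = λ {a} {b} {c} _ _ _ → ▷-selfDistributive a b c
  ; solve    = λ {a} {b} a∈Q b∈Q → a ▷ b , closed a b a∈Q b∈Q , ▷-involutive a b ,
                 λ y _ a▷y≡b → trans (sym (▷-involutive a y)) (cong (a ▷_) a▷y≡b)
  }

fromℚᵘ-+ : ∀ p q → fromℚᵘ (p ℚᵘ.+ q) ≡ fromℚᵘ p + fromℚᵘ q
fromℚᵘ-+ p q = ℚP.toℚᵘ-injective (begin
  toℚᵘ (fromℚᵘ (p ℚᵘ.+ q))                    ≈⟨ ℚP.toℚᵘ-fromℚᵘ (p ℚᵘ.+ q) ⟩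
  p ℚᵘ.+ q                                     ≈⟨ ℚᵘP.+-cong (ℚP.toℚᵘ-fromℚᵘ p) (ℚP.toℚᵘ-fromℚᵘ q) ⟨
  toℚᵘ (fromℚᵘ p) ℚᵘ.+ toℚᵘ (fromℚᵘ q)         ≈⟨ ℚP.toℚᵘ-homo-+ (fromℚᵘ p) (fromℚᵘ q) ⟨
  toℚᵘ (fromℚᵘ p + fromℚᵘ q)                   ∎)
  where open ℚᵘP.≃-Reasoning

fromℚᵘ-neg : ∀ p → fromℚᵘ (ℚᵘ.- p) ≡ - fromℚᵘ p
fromℚᵘ-neg p = ℚP.toℚᵘ-injective (begin
  toℚᵘ (fromℚᵘ (ℚᵘ.- p))   ≈⟨ ℚP.toℚᵘ-fromℚᵘ (ℚᵘ.- p) ⟩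
  ℚᵘ.- p                   ≈⟨ ℚᵘP.-‿cong (ℚP.toℚᵘ-fromℚᵘ p) ⟨
  ℚᵘ.- toℚᵘ (fromℚᵘ p)     ≈⟨ ℚP.toℚᵘ-homo‿- (fromℚᵘ p) ⟨
  toℚᵘ (- fromℚᵘ p)        ∎)
  where open ℚᵘP.≃-Reasoning

multiple : ℕ → ℤ → ℚ
multiple e k = k / suc e

multiple-+ : ∀ e a b → multiple e (a ℤ.+ b) ≡ multiple e a + multiple e b
multiple-+ e a b =
  trans (ℚP.fromℚᵘ-cong same-denominator) (fromℚᵘ-+ (ℚᵘ.mkℚᵘ a e) (ℚᵘ.mkℚᵘ b e))
  where
  open ℤSolver.+-*-Solver
  same-denominator : ℚᵘ.mkℚᵘ (a ℤ.+ b) e ℚᵘ.≃ ℚᵘ.mkℚᵘ a e ℚᵘ.+ ℚᵘ.mkℚᵘ b e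
  same-denominator = ℚᵘ.*≡* (trans (cong ((a ℤ.+ b) ℤ.*_) (ℤP.pos-* (suc e) (suc e)))
    (solve 3 (λ a b d → (a :+ b) :* (d :* d) := (a :* d :+ b :* d) :* d) refl a b (+ suc e)))

multiple-▷ : ∀ e a b → multiple e (a ▷ℤ b) ≡ multiple e a ▷ multiple e b
multiple-▷ e a b = begin
  multiple e ((a ℤ.+ a) ℤ.+ ℤ.- b)                      ≡⟨ multiple-+ e (a ℤ.+ a) (ℤ.- b) ⟩
  multiple e (a ℤ.+ a) + multiple e (ℤ.- b)             ≡⟨ cong₂ _+_ (multiple-+ e a a) (fromℚᵘ-neg (ℚᵘ.mkℚᵘ b e)) ⟩
  (multiple e a + multiple e a) + - multiple e b        ∎
  where open ≡-Reasoning

rescale : ∀ x k e → ↧ₙ x ℕ.* suc k ≡ suc e → x ≡ multiple e (↥ x ℤ.* + suc k)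
rescale x@record{} k e dk≡e =
  trans (sym (ℚP.fromℚᵘ-toℚᵘ x))
        (ℚP.fromℚᵘ-cong {toℚᵘ x} {ℚᵘ.mkℚᵘ (↥ x ℤ.* + suc k) e} (ℚᵘ.*≡* cross))
  where
  open ℤSolver.+-*-Solver
  cross : ↥ x ℤ.* + suc e ≡ ↥ x ℤ.* + suc k ℤ.* ↧ x
  cross = trans (cong (λ m → ↥ x ℤ.* + m) (sym dk≡e))
    (trans (cong (↥ x ℤ.*_) (ℤP.pos-* (↧ₙ x) (suc k)))
      (solve 3 (λ n d k → n :* (d :* k) := n :* k :* d) refl (↥ x) (↧ x) (+ suc k)))

-- Integer multiples of 1/(e+1) lying in a ▷-closed T ∋ 0 form a ▷-closed
-- subset of ℤ containing 0, hence are closed under addition; since any two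
-- rationals are such multiples for a common e, T is closed under addition.
▷-closed⇒+-closed : {ℓ : Level} {T : Pred ℚ ℓ} → 0ℚ ∈ T → ▷-Closed T →
                    ∀ {x y} → x ∈ T → y ∈ T → (x + y) ∈ T
▷-closed⇒+-closed {T = T} 0∈T closed {x@record{}} {y@record{}} x∈T y∈T =
  subst (_∈ T) x+y≡ (P-+ a b (subst (_∈ T) x≡ x∈T) (subst (_∈ T) y≡ y∈T))
  where
  -- the common denominator e + 1 = (↧ x)(↧ y)
  e : ℕ
  e = ℕ.pred (↧ₙ x ℕ.* ↧ₙ y)
  open ReflectionClosed (λ k → multiple e k ∈ T) (subst (_∈ T) (sym (ℚP.0/n≡0 (suc e))) 0∈T)
         (λ {a} {b} a∈ b∈ → subst (_∈ T) (sym (multiple-▷ e a b))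
                                  (closed (multiple e a) (multiple e b) a∈ b∈))
  a b : ℤ
  a = ↥ x ℤ.* ↧ y
  b = ↥ y ℤ.* ↧ x
  x≡ : x ≡ multiple e a
  x≡ = rescale x (ℕ.pred (↧ₙ y)) e refl
  y≡ : y ≡ multiple e b
  y≡ = rescale y (ℕ.pred (↧ₙ x)) e (ℕP.*-comm (↧ₙ y) (↧ₙ x))
  x+y≡ : multiple e (a ℤ.+ b) ≡ x + y
  x+y≡ = trans (multiple-+ e a b) (sym (cong₂ _+_ x≡ y≡))

▷-closed⇒subgroup : {ℓ : Level} {T : Pred ℚ ℓ} → 0ℚ ∈ T → ▷-Closed T → IsAddSubgroup T
▷-closed⇒subgroup {T = T} 0∈T closed = record
  { zero∈      = 0∈T
  ; +-closed   = ▷-closed⇒+-closed {T = T} 0∈T closed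
  ; neg-closed = λ {a} a∈T → subst (_∈ T) (0▷ a) (closed 0ℚ a 0∈T a∈T)
  }

coset-▷-closed : {ℓ : Level} {H : Pred ℚ ℓ} → IsAddSubgroup H → ∀ x → ▷-Closed (Coset H x)
coset-▷-closed G x _ _ (h₁ , h₁∈H , refl) (h₂ , h₂∈H , refl) =
  h₁ ▷ h₂ , +-closed (+-closed h₁∈H h₁∈H) (neg-closed h₂∈H) , ▷-translate h₁ h₂ x
  where open IsAddSubgroup G

▷-closed-≐ : {ℓ₁ ℓ₂ : Level} {S : Pred ℚ ℓ₁} {Q : Pred ℚ ℓ₂} → S ≐ Q → ▷-Closed Q → ▷-Closed S
▷-closed-≐ (S⊆Q , Q⊆S) closed a b a∈S b∈S = Q⊆S (a ▷ b) (closed a b (S⊆Q a a∈S) (S⊆Q b b∈S))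

Shift : {ℓ : Level} → Pred ℚ ℓ → ℚ → Pred ℚ ℓ
Shift S s h = (h + s) ∈ S

shift-0 : {ℓ : Level} {S : Pred ℚ ℓ} {s : ℚ} → s ∈ S → 0ℚ ∈ Shift S s
shift-0 {S = S} {s} = subst (_∈ S) (sym (ℚP.+-identityˡ s))

shift-▷-closed : {ℓ : Level} {S : Pred ℚ ℓ} {s : ℚ} → ▷-Closed S → ▷-Closed (Shift S s)
shift-▷-closed {S = S} {s} closed a b a∈ b∈ =
  subst (_∈ S) (▷-translate a b s) (closed (a + s) (b + s) a∈ b∈)

shift-coset : {ℓ : Level} (S : Pred ℚ ℓ) (s : ℚ) → S ≐ Coset (Shift S s) s
shift-coset S s = (λ y y∈S → y - s , subst (_∈ S) (y≡y-s+s y) y∈S , y≡y-s+s y)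
                , (λ { y (h , h∈ , refl) → h∈ })
  where
  y≡y-s+s : ∀ y → y ≡ (y - s) + s
  y≡y-s+s y = solve 2 (λ y s → y := (y :- s) :+ s) refl y s
    where open +-*-Solver

lemma5p1 : {ℓ : Level} (S : Pred ℚ ℓ) →
    ((NonEmpty S × IsSubrack S) →
      Σ (Pred ℚ ℓ) λ H → IsAddSubgroup H × ∃[ x ] (S ≐ Coset H x))
    × ((H : Pred ℚ ℓ) → IsAddSubgroup H → (x : ℚ) → S ≐ Coset H x →
      NonEmpty S × IsSubrack S)
lemma5p1 {ℓ} S = subrack⇒coset , coset⇒subrack
  where
  subrack⇒coset : NonEmpty S × IsSubrack S →
                  Σ (Pred ℚ ℓ) λ H → IsAddSubgroup H × ∃[ x ] (S ≐ Coset H x)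
  subrack⇒coset ((s , s∈S) , rack) =
    Shift S s , ▷-closed⇒subgroup {T = Shift S s} (shift-0 {S = S} s∈S) H-▷-closed ,
    s , shift-coset S s
    where
    H-▷-closed : ▷-Closed (Shift S s)
    H-▷-closed = shift-▷-closed {S = S} (λ _ _ → IsSubrack.closed rack)
  coset⇒subrack : (H : Pred ℚ ℓ) → IsAddSubgroup H → (x : ℚ) → S ≐ Coset H x →
                  NonEmpty S × IsSubrack S
  coset⇒subrack H G x S≐H+x =
    (x , proj₂ S≐H+x x (0ℚ , IsAddSubgroup.zero∈ G , sym (ℚP.+-identityˡ x))) ,
    ▷-closed⇒subrack (▷-closed-≐ S≐H+x (coset-▷-closed G x))
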